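{- Let $G$ be an Abelian group (written multiplicatively), $R$ a commutative ring with unity, and $\varphi:\mathbb{Z}^d\to G$ a homomorphism; let $\varphi':\mathbb{Z}^d\to G$ be the homomorphism $\varphi'(\alpha)=\varphi(\alpha)^{ -1}$. Let $\Delta$ be a $d$-dimensional half-open simplex with vertices $v_1,\dots,v_{d+1}\in\mathbb{Z}^d$, and let $\Delta'$ be the half-open simplex with the same vertices and the complementary set of facets removed. Then $$h^*(\Delta',\varphi;t)=\varphi(v_1+\dots+v_{d+1})\,t^{d+1}\,h^*(\Delta,\varphi';1/t).$$ Moreover, as rational functions in $t$ over $R[G]$, $$\mathcal E(\Delta,\varphi';t^{ -1})=(-1)^{d+1}\mathcal E(\Delta',\varphi;t).$$
   Context: $R[G]$ is the group ring. A $d$-dimensional half-open simplex with vertices $v_1,\dots,v_{d+1}$ (affinely independent) is a set $\Delta=\{\sum_i\lambda_iv_i:\sum_i\lambda_i=1,\ \lambda_i>0\ (i\in S),\ \lambda_i\ge0\ (i\notin S)\}$ for some $S\subseteq\{1,\dots,d+1\}$ (the facets opposite $v_i$, $i\in S$, are removed); $\Delta'$ is the same with $S$ replaced by its complement. For such $\Delta$, with $u_i=(v_i,1)\in\mathbb{Z}^{d+1}$, its fundamental parallelepiped is $\Pi=\{\sum_i\lambda_iu_i:\lambda_i\in(0,1]\ (i\in S),\ \lambda_i\in[0,1)\ (i\notin S)\}$, and its $h^*_\varphi$-polynomial is $h^*(\Delta,\varphi;t)=\sum_{(\beta,m)\in\Pi\cap\mathbb{Z}^{d+1}}\varphi(\beta)t^m\in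 R[G][t]$. With $n\Delta=\{\sum_i\lambda_iv_i:\sum_i\lambda_i=n,\ \text{same strict/weak conditions}\}$, the $\varphi$-Ehrhart series is $\mathcal E(\Delta,\varphi;t)=\sum_{n\ge0}\big(\sum_{\alpha\in n\Delta\cap\mathbb{Z}^d}\varphi(\alpha)\big)t^n$, which equals the rational function $h^*(\Delta,\varphi;t)/\prod_{i=1}^{d+1}(1-\varphi(v_i)t)$; $\mathcal E(\Delta,\varphi';t^{ -1})$ means this rational function (for $\varphi'$) with $t$ replaced by $t^{ -1}$. -}

module Defs where

open import Level using (_⊔_)
open import Algebra.Bundles using (CommutativeRing; AbelianGroup)
open import Data.Bool using (Bool; true; false)
open import Data.Nat as ℕ using (ℕ; zero; suc)
open import Data.Integer as ℤ using (ℤ)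
open import Data.Rational as ℚ using (ℚ; 0ℚ; 1ℚ; _/_)
open import Data.Fin using (Fin; zero; suc)
open import Data.Vec as Vec using (Vec)
open import Data.List using (List; []; _∷_; _++_; map; concatMap)
open import Data.List.Relation.Binary.Permutation.Propositional using (_↭_)
open import Data.List.Membership.Propositional using (_∈_)
open import Data.List.Relation.Unary.Unique.Propositional using (Unique)
open import Data.Product using (Σ; _×_; _,_; ∃)
open import Relation.Binary.PropositionalEquality using (_≡_)

toℚ : ℤ → ℚ
toℚ n = n / 1

∑ℚ : ∀ {n} → (Fin n → ℚ) → ℚ
∑ℚ {zero} f = 0ℚ
∑ℚ {suc n} f = f zero ℚ.+ ∑ℚ (λ i → f (suc i))

vsum : ∀ {n d} → (Fin n → Vec ℤ d) → Vec ℤ d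
vsum {zero} {d} v = Vec.replicate d (ℤ.+ 0)
vsum {suc n} v = Vec.zipWith ℤ._+_ (v zero) (vsum (λ i → v (suc i)))

AffinelyIndependent : ∀ {d} → (Fin (suc d) → Vec ℤ d) → Set
AffinelyIndependent {d} v =
  (c : Fin (suc d) → ℚ) → ∑ℚ c ≡ 0ℚ →
  ((j : Fin d) → ∑ℚ (λ i → c i ℚ.* toℚ (Vec.lookup (v i) j)) ≡ 0ℚ) →
  (i : Fin (suc d)) → c i ≡ 0ℚ

-- S i = true  : i ∈ S, i.e. the facet opposite vᵢ is removed, λᵢ ∈ (0,1]
-- S i = false : i ∉ S, λᵢ ∈ [0,1)
InBox : Bool → ℚ → Set
InBox true x = (0ℚ ℚ.< x) × (x ℚ.≤ 1ℚ)
InBox false x = (0ℚ ℚ.≤ x) × (x ℚ.< 1ℚ)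

Point : ℕ → Set
Point d = Vec ℤ d × ℤ

-- membership in the fundamental parallelepiped Π of the half-open simplex
-- with vertices v and removed-facet set S:  (β , m) = ∑ λᵢ (vᵢ , 1)
InΠ : ∀ {d} → (Fin (suc d) → Vec ℤ d) → (Fin (suc d) → Bool) → Point d → Set
InΠ {d} v S (β , m) =
  Σ (Fin (suc d) → ℚ) λ c →
    ((i : Fin (suc d)) → InBox (S i) (c i)) ×
    ((j : Fin d) → toℚ (Vec.lookup β j) ≡ ∑ℚ (λ i → c i ℚ.* toℚ (Vec.lookup (v i) j))) ×
    (toℚ m ≡ ∑ℚ c)

Enumerates : ∀ {d} → (Point d → Set) → List (Point d) → Set
Enumerates {d} P L = ((x : Point d) → (x ∈ L → P x) × (P x → x ∈ L)) × Unique L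

IsHom : ∀ {a b} (G : AbelianGroup a b) {d} → (Vec ℤ d → AbelianGroup.Carrier G) → Set b
IsHom G {d} φ = (x y : Vec ℤ d) → φ (Vec.zipWith ℤ._+_ x y) ≈ (φ x ∙ φ y)
  where open AbelianGroup G

-- The Laurent polynomial ring R[G][t, t⁻¹] (containing R[G][t]),
-- realised as formal R-linear combinations of monomials g·tⁿ (g ∈ G, n ∈ ℤ),
-- modulo the relations of the free R-module on the setoid G × ℤ.

module GroupRing {c ℓ a b} (R : CommutativeRing c ℓ) (G : AbelianGroup a b) where
  private
    module R = CommutativeRing R
    module G = AbelianGroup G

  record Term : Set (c ⊔ a) where
    constructor term
    field
      coeff : R.Carrier
      grp   : G.Carrier
      deg   : ℤ

  LPoly : Set (c ⊔ a)
  LPoly = List Term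

  infix 4 _≋_
  data _≋_ : LPoly → LPoly → Set (c ⊔ ℓ ⊔ a ⊔ b) where
    ≋-refl  : ∀ {xs} → xs ≋ xs
    ≋-sym   : ∀ {xs ys} → xs ≋ ys → ys ≋ xs
    ≋-trans : ∀ {xs ys zs} → xs ≋ ys → ys ≋ zs → xs ≋ zs
    ≋-perm  : ∀ {xs ys} → xs ↭ ys → xs ≋ ys
    ≋-cons  : ∀ {x xs ys} → xs ≋ ys → (x ∷ xs) ≋ (x ∷ ys)
    ≋-resp  : ∀ {r r′ g g′ n xs} → r R.≈ r′ → g G.≈ g′ →
              (term r g n ∷ xs) ≋ (term r′ g′ n ∷ xs)
    ≋-merge : ∀ {r s g n xs} →
              (term r g n ∷ term s g n ∷ xs) ≋ (term (r R.+ s) g n ∷ xs)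
    ≋-zero  : ∀ {g n xs} → (term R.0# g n ∷ xs) ≋ xs

  mono : R.Carrier → G.Carrier → ℤ → LPoly
  mono r g n = term r g n ∷ []

  one : LPoly
  one = mono R.1# G.ε (ℤ.+ 0)

  infixl 6 _⊕_
  _⊕_ : LPoly → LPoly → LPoly
  _⊕_ = _++_

  infixl 7 _⊛_
  _⊛_ : LPoly → LPoly → LPoly
  xs ⊛ ys = concatMap (λ x → map (λ y → mulT x y) ys) xs
    where
      mulT : Term → Term → Term
      mulT (term r g m) (term s h n) = term (r R.* s) (g G.∙ h) (m ℤ.+ n)

  scale : R.Carrier → LPoly → LPoly
  scale r = map (λ { (term s g n) → term (r R.* s) g n })

  subInv : LPoly → LPoly
  subInv = map (λ { (term s g n) → term s g (ℤ.- n) })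

  ∏ : ∀ {n} → (Fin n → LPoly) → LPoly
  ∏ {zero} f = one
  ∏ {suc n} f = f zero ⊛ ∏ (λ i → f (suc i))

  powR : R.Carrier → ℕ → R.Carrier
  powR r zero = R.1#
  powR r (suc n) = r R.* powR r n

  module _ {d : ℕ} where
    hstar : (Vec ℤ d → G.Carrier) → List (Point d) → LPoly
    hstar ψ L = map (λ { (β , m) → term R.1# (ψ β) m }) L

    den : (Fin (suc d) → Vec ℤ d) → (Vec ℤ d → G.Carrier) → LPoly
    den v ψ = ∏ (λ i → one ⊕ mono (R.- R.1#) (ψ (v i)) (ℤ.+ 1))

  -- rational functions as (numerator , denominator); all denominators used
  -- are products of factors 1 − g t^{±1}, which are non-zero-divisors, so
  -- equality in the localisation is equality of cross products.
  Frac : Set (c ⊔ a)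
  Frac = LPoly × LPoly

  infix 4 _≈F_
  _≈F_ : Frac → Frac → Set (c ⊔ ℓ ⊔ a ⊔ b)
  (p , q) ≈F (p′ , q′) = p ⊛ q′ ≋ p′ ⊛ q

  subInvF : Frac → Frac
  subInvF (p , q) = subInv p , subInv q

  scaleF : R.Carrier → Frac → Frac
  scaleF r (p , q) = scale r p , q

  Ehrhart : ∀ {d} → (Fin (suc d) → Vec ℤ d) → (Vec ℤ d → G.Carrier) → List (Point d) → Frac
  Ehrhart v ψ L = hstar ψ L , den v ψ

module _ {c ℓ a b} (R : CommutativeRing c ℓ) (G : AbelianGroup a b) where
  open GroupRing R G
  open CommutativeRing R using (1#; -_)
  open AbelianGroup G using (_⁻¹)

  ReciprocityConclusion : ∀ {d} → (φ : Vec ℤ d → AbelianGroup.Carrier G) →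
    (v : Fin (suc d) → Vec ℤ d) → (L L′ : List (Point d)) → Set (c ⊔ ℓ ⊔ a ⊔ b)
  ReciprocityConclusion {d} φ v L L′ =
    (hstar φ L′ ≋ mono 1# (φ (vsum v)) (ℤ.+ suc d) ⊛ subInv (hstar φ′ L))
    × (subInvF (Ehrhart v φ′ L) ≈F scaleF (powR (- 1#) (suc d)) (Ehrhart v φ L′))
    where
      φ′ : Vec ℤ d → AbelianGroup.Carrier G
      φ′ α = φ α ⁻¹

-- On coefficient vectors, λᵢ ↦ 1 − λᵢ exchanges the half-open boxes (0,1] and [0,1), so the
-- reflection (β , m) ↦ (v₁ + … + v_{d+1} − β , d + 1 − m) maps the lattice points of Π(Δ)
-- bijectively onto those of Π(Δ′). As φ(v₁ + … + v_{d+1} − β) = φ(v₁ + … + v_{d+1}) φ′(β), the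
-- monomial of a reflected point is φ(v₁ + … + v_{d+1}) t^{d+1} times the monomial of the original
-- point with t replaced by t⁻¹, which is the h*-identity. The Ehrhart identity follows since every
-- factor of the denominator satisfies 1 − φ′(vᵢ) t⁻¹ = − φ′(vᵢ) t⁻¹ (1 − φ(vᵢ) t).

module Submission where

open import Defs
open import Level using (_⊔_)
open import Algebra.Bundles using (CommutativeRing; AbelianGroup; CommutativeMonoid)
open import Algebra.Structures.Biased using (isCommutativeMonoidˡ)
import Algebra.Properties.Monoid.Sum as MonoidSum
import Algebra.Properties.CommutativeSemigroup as CommutativeSemigroupProperties
import Algebra.Properties.Ring as RingProperties
import Algebra.Properties.Group as GroupProperties
import Algebra.Properties.AbelianGroup as AbelianGroupProperties
open import Data.Bool using (Bool; true; false; not)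
open import Data.Bool.Properties using (not-involutive)
open import Data.Nat using (ℕ; zero; suc)
open import Data.Nat.Coprimality using (1-coprimeTo) renaming (sym to coprime-sym)
open import Data.Integer as ℤ using (ℤ; +_; -[1+_])
import Data.Integer.Properties as ℤ
import Data.Integer.Solver as ℤ-Solver
open import Data.Rational as ℚ using (ℚ; 1ℚ; mkℚ)
import Data.Rational.Properties as ℚ
import Data.Rational.Solver as ℚ-Solver
open import Data.Fin using (Fin; zero; suc)
open import Data.Vec as Vec using (Vec; []; _∷_)
import Data.Vec.Properties as Vec
open import Data.List using (List; []; _∷_; _++_; map; concatMap)
import Data.List.Properties as List
open import Data.List.Membership.Propositional using (_∈_)
open import Data.List.Membership.Propositional.Properties using (∈-map⁺; ∈-map⁻)
open import Data.List.Membership.Propositional.Properties.WithK using (unique∧set⇒bag)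
import Data.List.Relation.Unary.Unique.Propositional.Properties as Unique
open import Data.List.Relation.Binary.BagAndSetEquality using (∼bag⇒↭)
open import Data.List.Relation.Binary.Permutation.Propositional as ↭ using (_↭_; prep; swap)
import Data.List.Relation.Binary.Permutation.Propositional.Properties as ↭
open import Data.Product using (_×_; _,_; proj₁; proj₂)
open import Function using (_∘_)
open import Function.Bundles using (mk⇔)
open import Relation.Binary.Bundles using (Setoid)
open import Relation.Binary.PropositionalEquality as ≡
  using (_≡_; refl; cong; cong₂; subst; module ≡-Reasoning)
import Relation.Binary.Reasoning.Setoid as SetoidReasoning

private
  toℚ-mkℚ : ∀ i → toℚ i ≡ mkℚ i 0 (coprime-sym (1-coprimeTo _))
  toℚ-mkℚ i = ℚ.↥p/↧p≡p (mkℚ i 0 (coprime-sym (1-coprimeTo _)))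

toℚ-+ : ∀ i j → toℚ (i ℤ.+ j) ≡ toℚ i ℚ.+ toℚ j
toℚ-+ i j = ≡.sym (≡.trans (cong₂ ℚ._+_ (toℚ-mkℚ i) (toℚ-mkℚ j))
  (cong₂ (λ x y → (x ℤ.+ y) ℚ./ 1) (ℤ.*-identityʳ i) (ℤ.*-identityʳ j)))

toℚ-neg : ∀ i → toℚ (ℤ.- i) ≡ ℚ.- toℚ i
toℚ-neg i = ≡.trans (toℚ-mkℚ (ℤ.- i)) (≡.trans (mkℚ-neg i) (cong ℚ.-_ (≡.sym (toℚ-mkℚ i))))
  where
  mkℚ-neg : ∀ i → mkℚ (ℤ.- i) 0 (coprime-sym (1-coprimeTo _)) ≡ ℚ.- mkℚ i 0 (coprime-sym (1-coprimeTo _))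
  mkℚ-neg (+ zero)  = refl
  mkℚ-neg (+ suc n) = refl
  mkℚ-neg -[1+ n ]  = refl

toℚ-- : ∀ i j → toℚ (i ℤ.- j) ≡ toℚ i ℚ.- toℚ j
toℚ-- i j = ≡.trans (toℚ-+ i (ℤ.- j)) (cong (toℚ i ℚ.+_) (toℚ-neg j))

toℚ-lookup-vsum : ∀ {n d} (w : Fin n → Vec ℤ d) j →
  toℚ (Vec.lookup (vsum w) j) ≡ ∑ℚ (λ i → toℚ (Vec.lookup (w i) j))
toℚ-lookup-vsum {zero}  w j = cong toℚ (Vec.lookup-replicate j (+ 0))
toℚ-lookup-vsum {suc n} w j = begin
  toℚ (Vec.lookup (vsum w) j)
    ≡⟨ cong toℚ (Vec.lookup-zipWith ℤ._+_ j (w zero) (vsum (w ∘ suc))) ⟩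
  toℚ (Vec.lookup (w zero) j ℤ.+ Vec.lookup (vsum (w ∘ suc)) j)
    ≡⟨ toℚ-+ (Vec.lookup (w zero) j) _ ⟩
  toℚ (Vec.lookup (w zero) j) ℚ.+ toℚ (Vec.lookup (vsum (w ∘ suc)) j)
    ≡⟨ cong (toℚ (Vec.lookup (w zero) j) ℚ.+_) (toℚ-lookup-vsum (w ∘ suc) j) ⟩
  ∑ℚ (λ i → toℚ (Vec.lookup (w i) j)) ∎
  where open ≡-Reasoning

module _ where
  open ℚ-Solver.+-*-Solver

  ∑ℚ-complement : ∀ {n} (c : Fin n → ℚ) → ∑ℚ (λ i → 1ℚ ℚ.- c i) ≡ toℚ (+ n) ℚ.- ∑ℚ c
  ∑ℚ-complement {zero}  c = refl
  ∑ℚ-complement {suc n} c = begin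
    (1ℚ ℚ.- c zero) ℚ.+ ∑ℚ (λ i → 1ℚ ℚ.- c (suc i))
      ≡⟨ cong ((1ℚ ℚ.- c zero) ℚ.+_) (∑ℚ-complement (c ∘ suc)) ⟩
    (1ℚ ℚ.- c zero) ℚ.+ (toℚ (+ n) ℚ.- ∑ℚ (c ∘ suc))
      ≡⟨ solve 3 (λ c N C → (con 1ℚ :- c) :+ (N :- C) := (con 1ℚ :+ N) :- (c :+ C))
           refl (c zero) (toℚ (+ n)) (∑ℚ (c ∘ suc)) ⟩
    (1ℚ ℚ.+ toℚ (+ n)) ℚ.- ∑ℚ c
      ≡⟨ cong (ℚ._- ∑ℚ c) (≡.sym (toℚ-+ (+ 1) (+ n))) ⟩
    toℚ (+ suc n) ℚ.- ∑ℚ c ∎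
    where open ≡-Reasoning

  ∑ℚ-complement-* : ∀ {n} (c x : Fin n → ℚ) →
    ∑ℚ (λ i → (1ℚ ℚ.- c i) ℚ.* x i) ≡ ∑ℚ x ℚ.- ∑ℚ (λ i → c i ℚ.* x i)
  ∑ℚ-complement-* {zero}  c x = refl
  ∑ℚ-complement-* {suc n} c x =
    ≡.trans (cong ((1ℚ ℚ.- c zero) ℚ.* x zero ℚ.+_) (∑ℚ-complement-* (c ∘ suc) (x ∘ suc)))
      (solve 4 (λ c x X Y → (con 1ℚ :- c) :* x :+ (X :- Y) := (x :+ X) :- (c :* x :+ Y))
        refl (c zero) (x zero) (∑ℚ (x ∘ suc)) (∑ℚ (λ i → c (suc i) ℚ.* x (suc i))))

InBox-complement : ∀ b {x} → InBox b x → InBox (not b) (1ℚ ℚ.- x)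
InBox-complement true  {x} (0<x , x≤1) =
  subst (ℚ._≤ 1ℚ ℚ.- x) (ℚ.+-inverseʳ 1ℚ) (ℚ.+-monoʳ-≤ 1ℚ (ℚ.neg-antimono-≤ x≤1)) ,
  subst (1ℚ ℚ.- x ℚ.<_) (ℚ.+-identityʳ 1ℚ) (ℚ.+-monoʳ-< 1ℚ (ℚ.neg-antimono-< 0<x))
InBox-complement false {x} (0≤x , x<1) =
  subst (ℚ._< 1ℚ ℚ.- x) (ℚ.+-inverseʳ 1ℚ) (ℚ.+-monoʳ-< 1ℚ (ℚ.neg-antimono-< x<1)) ,
  subst (1ℚ ℚ.- x ℚ.≤_) (ℚ.+-identityʳ 1ℚ) (ℚ.+-monoʳ-≤ 1ℚ (ℚ.neg-antimono-≤ 0≤x))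

module _ where
  open ℤ-Solver.+-*-Solver

  i-[i-j]≡j : ∀ i j → i ℤ.- (i ℤ.- j) ≡ j
  i-[i-j]≡j = solve 2 (λ i j → i :- (i :- j) := j) refl

  i-j+j≡i : ∀ i j → (i ℤ.- j) ℤ.+ j ≡ i
  i-j+j≡i = solve 2 (λ i j → (i :- j) :+ j := i) refl

infixl 6 _⊖_
_⊖_ : ∀ {k} → Vec ℤ k → Vec ℤ k → Vec ℤ k
_⊖_ = Vec.zipWith ℤ._-_

⊖-involutive : ∀ {k} (a b : Vec ℤ k) → a ⊖ (a ⊖ b) ≡ b
⊖-involutive []      []      = refl
⊖-involutive (x ∷ a) (y ∷ b) = cong₂ _∷_ (i-[i-j]≡j x y) (⊖-involutive a b)

⊖-+-cancel : ∀ {k} (a b : Vec ℤ k) → Vec.zipWith ℤ._+_ (a ⊖ b) b ≡ a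
⊖-+-cancel []      []      = refl
⊖-+-cancel (x ∷ a) (y ∷ b) = cong₂ _∷_ (i-j+j≡i x y) (⊖-+-cancel a b)

module _ {d : ℕ} (v : Fin (suc d) → Vec ℤ d) where

  reflect : Point d → Point d
  reflect (β , m) = vsum v ⊖ β , + suc d ℤ.- m

  reflect-involutive : ∀ x → reflect (reflect x) ≡ x
  reflect-involutive (β , m) = cong₂ _,_ (⊖-involutive (vsum v) β) (i-[i-j]≡j (+ suc d) m)

  reflect-injective : ∀ {x y} → reflect x ≡ reflect y → x ≡ y
  reflect-injective {x} {y} eq =
    ≡.trans (≡.sym (reflect-involutive x)) (≡.trans (cong reflect eq) (reflect-involutive y))

  InΠ-reflect : ∀ S x → InΠ v S x → InΠ v (not ∘ S) (reflect x)
  InΠ-reflect S (β , m) (c , inBox , coords , height) =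
    (λ i → 1ℚ ℚ.- c i) , (λ i → InBox-complement (S i) (inBox i)) , coords′ , height′
    where
    open ≡-Reasoning
    coords′ : ∀ j → toℚ (Vec.lookup (vsum v ⊖ β) j) ≡
                    ∑ℚ (λ i → (1ℚ ℚ.- c i) ℚ.* toℚ (Vec.lookup (v i) j))
    coords′ j = begin
      toℚ (Vec.lookup (vsum v ⊖ β) j)
        ≡⟨ cong toℚ (Vec.lookup-zipWith ℤ._-_ j (vsum v) β) ⟩
      toℚ (Vec.lookup (vsum v) j ℤ.- Vec.lookup β j)
        ≡⟨ toℚ-- (Vec.lookup (vsum v) j) (Vec.lookup β j) ⟩
      toℚ (Vec.lookup (vsum v) j) ℚ.- toℚ (Vec.lookup β j)
        ≡⟨ cong₂ ℚ._-_ (toℚ-lookup-vsum v j) (coords j) ⟩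
      ∑ℚ (λ i → toℚ (Vec.lookup (v i) j)) ℚ.- ∑ℚ (λ i → c i ℚ.* toℚ (Vec.lookup (v i) j))
        ≡⟨ ∑ℚ-complement-* c (λ i → toℚ (Vec.lookup (v i) j)) ⟨
      ∑ℚ (λ i → (1ℚ ℚ.- c i) ℚ.* toℚ (Vec.lookup (v i) j)) ∎
    height′ : toℚ (+ suc d ℤ.- m) ≡ ∑ℚ (λ i → 1ℚ ℚ.- c i)
    height′ = begin
      toℚ (+ suc d ℤ.- m)          ≡⟨ toℚ-- (+ suc d) m ⟩
      toℚ (+ suc d) ℚ.- toℚ m      ≡⟨ cong (λ q → toℚ (+ suc d) ℚ.- q) height ⟩
      toℚ (+ suc d) ℚ.- ∑ℚ c       ≡⟨ ∑ℚ-complement c ⟨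
      ∑ℚ (λ i → 1ℚ ℚ.- c i)        ∎

  InΠ-cong : ∀ {S S′} → (∀ i → S i ≡ S′ i) → ∀ x → InΠ v S x → InΠ v S′ x
  InΠ-cong S≗S′ x (c , inBox , rest) = c , (λ i → subst (λ s → InBox s (c i)) (S≗S′ i) (inBox i)) , rest

  InΠ-reflect⁻ : ∀ S x → InΠ v (not ∘ S) x → InΠ v S (reflect x)
  InΠ-reflect⁻ S x = InΠ-cong (not-involutive ∘ S) (reflect x) ∘ InΠ-reflect (not ∘ S) x

  enumeration-reflect : ∀ S {L L′ : List (Point d)} →
    Enumerates (InΠ v S) L → Enumerates (InΠ v (not ∘ S)) L′ → L′ ↭ map reflect L
  enumeration-reflect S {L} {L′} (∈L⇔ , unique) (∈L′⇔ , unique′) =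
    ∼bag⇒↭ (unique∧set⇒bag unique′ (Unique.map⁺ reflect-injective unique) (mk⇔ to from))
    where
    to : ∀ {x} → x ∈ L′ → x ∈ map reflect L
    to {x} x∈L′ = subst (_∈ map reflect L) (reflect-involutive x)
      (∈-map⁺ reflect (proj₂ (∈L⇔ (reflect x)) (InΠ-reflect⁻ S x (proj₁ (∈L′⇔ x) x∈L′))))
    from : ∀ {x} → x ∈ map reflect L → x ∈ L′
    from x∈ with ∈-map⁻ reflect x∈
    ... | y , y∈L , refl = proj₂ (∈L′⇔ (reflect y)) (InΠ-reflect S y (proj₁ (∈L⇔ y) y∈L))


module LaurentPolynomialAlgebra {c ℓ a b} (R : CommutativeRing c ℓ) (G : AbelianGroup a b) where
  open GroupRing R G
  private
    module R = CommutativeRing R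
    module G = AbelianGroup G

  -- This is the term product inside _⊛_, so (x ∷ xs) ⊛ ys reduces to x ·ₗ ys ++ xs ⊛ ys.
  infixl 7 _·ₜ_
  _·ₜ_ : Term → Term → Term
  term r g m ·ₜ term s h n = term (r R.* s) (g G.∙ h) (m ℤ.+ n)

  infixr 7 _·ₗ_
  _·ₗ_ : Term → LPoly → LPoly
  x ·ₗ ys = map (x ·ₜ_) ys

  infix 4 _≈ₜ_
  _≈ₜ_ : Term → Term → Set (ℓ ⊔ b)
  term r g m ≈ₜ term s h n = r R.≈ s × g G.≈ h × m ≡ n

  ≋-setoid : Setoid (c ⊔ a) (c ⊔ ℓ ⊔ a ⊔ b)
  ≋-setoid = record
    { Carrier = LPoly ; _≈_ = _≋_
    ; isEquivalence = record { refl = ≋-refl ; sym = ≋-sym ; trans = ≋-trans } }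

  ≡⇒≋ : ∀ {xs ys} → xs ≡ ys → xs ≋ ys
  ≡⇒≋ refl = ≋-refl

  ∷-congˡ : ∀ {x y xs} → x ≈ₜ y → x ∷ xs ≋ y ∷ xs
  ∷-congˡ {term r g m} {term s h .m} (r≈s , g≈h , refl) = ≋-resp r≈s g≈h

  ∷-cong : ∀ {x y xs ys} → x ≈ₜ y → xs ≋ ys → x ∷ xs ≋ y ∷ ys
  ∷-cong x≈y xs≋ys = ≋-trans (∷-congˡ x≈y) (≋-cons xs≋ys)

  mono-cong : ∀ {r s g h m n} → r R.≈ s → g G.≈ h → m ≡ n → mono r g m ≋ mono s h n
  mono-cong r≈s g≈h m≡n = ∷-congˡ {term _ _ _} {term _ _ _} (r≈s , g≈h , m≡n)

  ∷-zero : ∀ {x xs} → Term.coeff x R.≈ R.0# → x ∷ xs ≋ xs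
  ∷-zero {term r g m} r≈0 = ≋-trans (≋-resp r≈0 G.refl) ≋-zero

  map-cong : ∀ {f g : Term → Term} xs → (∀ x → f x ≈ₜ g x) → map f xs ≋ map g xs
  map-cong []       f≈g = ≋-refl
  map-cong (x ∷ xs) f≈g = ∷-cong (f≈g x) (map-cong xs f≈g)

  ++-congˡ : ∀ {xs xs′} ys → xs ≋ xs′ → xs ++ ys ≋ xs′ ++ ys
  ++-congˡ ys ≋-refl          = ≋-refl
  ++-congˡ ys (≋-sym p)       = ≋-sym (++-congˡ ys p)
  ++-congˡ ys (≋-trans p q)   = ≋-trans (++-congˡ ys p) (++-congˡ ys q)
  ++-congˡ ys (≋-perm p)      = ≋-perm (↭.++⁺ʳ ys p)
  ++-congˡ ys (≋-cons p)      = ≋-cons (++-congˡ ys p)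
  ++-congˡ ys (≋-resp p q)    = ≋-resp p q
  ++-congˡ ys ≋-merge         = ≋-merge
  ++-congˡ ys ≋-zero          = ≋-zero

  ++-congʳ : ∀ xs {ys ys′} → ys ≋ ys′ → xs ++ ys ≋ xs ++ ys′
  ++-congʳ []       p = p
  ++-congʳ (x ∷ xs) p = ≋-cons (++-congʳ xs p)

  ++-cong : ∀ {xs xs′ ys ys′} → xs ≋ xs′ → ys ≋ ys′ → xs ++ ys ≋ xs′ ++ ys′
  ++-cong {xs′ = xs′} {ys = ys} p q = ≋-trans (++-congˡ ys p) (++-congʳ xs′ q)

  ·ₜ-comm : ∀ x y → x ·ₜ y ≈ₜ y ·ₜ x
  ·ₜ-comm (term r g m) (term s h n) = R.*-comm r s , G.comm g h , ℤ.+-comm m n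

  ·ₜ-assoc : ∀ x y z → (x ·ₜ y) ·ₜ z ≈ₜ x ·ₜ (y ·ₜ z)
  ·ₜ-assoc (term r g m) (term s h n) (term t k o) = R.*-assoc r s t , G.assoc g h k , ℤ.+-assoc m n o

  ·ₗ-congʳ : ∀ x {ys ys′} → ys ≋ ys′ → x ·ₗ ys ≋ x ·ₗ ys′
  ·ₗ-congʳ x ≋-refl        = ≋-refl
  ·ₗ-congʳ x (≋-sym p)     = ≋-sym (·ₗ-congʳ x p)
  ·ₗ-congʳ x (≋-trans p q) = ≋-trans (·ₗ-congʳ x p) (·ₗ-congʳ x q)
  ·ₗ-congʳ x (≋-perm p)    = ≋-perm (↭.map⁺ (x ·ₜ_) p)
  ·ₗ-congʳ x (≋-cons p)    = ≋-cons (·ₗ-congʳ x p)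
  ·ₗ-congʳ (term r g m) (≋-resp p q) = ≋-resp (R.*-congˡ p) (G.∙-congˡ q)
  ·ₗ-congʳ (term r g m) ≋-merge = ≋-trans ≋-merge (≋-resp (R.sym (R.distribˡ r _ _)) G.refl)
  ·ₗ-congʳ (term r g m) ≋-zero  = ∷-zero {term _ _ _} (R.zeroʳ r)

  ⊛-congʳ : ∀ xs {ys ys′} → ys ≋ ys′ → xs ⊛ ys ≋ xs ⊛ ys′
  ⊛-congʳ []       p = ≋-refl
  ⊛-congʳ (x ∷ xs) p = ++-cong (·ₗ-congʳ x p) (⊛-congʳ xs p)

  concatMap-↭ : (f : Term → LPoly) {xs ys : LPoly} → xs ↭ ys → concatMap f xs ↭ concatMap f ys
  concatMap-↭ f ↭.refl         = ↭.refl
  concatMap-↭ f (prep x p)     = ↭.++⁺ˡ (f x) (concatMap-↭ f p)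
  concatMap-↭ f (swap x y p)   =
    ↭.trans (↭.shifts (f x) (f y)) (↭.++⁺ˡ (f y) (↭.++⁺ˡ (f x) (concatMap-↭ f p)))
  concatMap-↭ f (↭.trans p q)  = ↭.trans (concatMap-↭ f p) (concatMap-↭ f q)

  ·ₗ-merge : ∀ r s g m ys zs →
    term r g m ·ₗ ys ++ term s g m ·ₗ ys ++ zs ≋ term (r R.+ s) g m ·ₗ ys ++ zs
  ·ₗ-merge r s g m []       zs = ≋-refl
  ·ₗ-merge r s g m (y ∷ ys) zs = ≋-trans
    (≋-cons (≋-perm (↭.shift (term s g m ·ₜ y) (term r g m ·ₗ ys) (term s g m ·ₗ ys ++ zs))))
    (≋-trans ≋-merge
      (∷-cong {term _ _ _} {term _ _ _} (R.sym (R.distribʳ (Term.coeff y) r s) , G.refl , refl)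
        (·ₗ-merge r s g m ys zs)))

  ·ₗ-zero : ∀ g m ys zs → term R.0# g m ·ₗ ys ++ zs ≋ zs
  ·ₗ-zero g m []       zs = ≋-refl
  ·ₗ-zero g m (y ∷ ys) zs = ≋-trans (∷-zero {term _ _ _} (R.zeroˡ _)) (·ₗ-zero g m ys zs)

  ⊛-congˡ : ∀ {xs xs′} ys → xs ≋ xs′ → xs ⊛ ys ≋ xs′ ⊛ ys
  ⊛-congˡ ys ≋-refl          = ≋-refl
  ⊛-congˡ ys (≋-sym p)       = ≋-sym (⊛-congˡ ys p)
  ⊛-congˡ ys (≋-trans p q)   = ≋-trans (⊛-congˡ ys p) (⊛-congˡ ys q)
  ⊛-congˡ ys (≋-perm p)      = ≋-perm (concatMap-↭ (_·ₗ ys) p)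
  ⊛-congˡ ys (≋-cons {x} p)  = ++-congʳ (x ·ₗ ys) (⊛-congˡ ys p)
  ⊛-congˡ ys (≋-resp {xs = xs} p q) =
    ++-congˡ (xs ⊛ ys) (map-cong ys λ _ → R.*-congʳ p , G.∙-congʳ q , refl)
  ⊛-congˡ ys (≋-merge {r} {s} {g} {m} {xs}) = ·ₗ-merge r s g m ys (xs ⊛ ys)
  ⊛-congˡ ys (≋-zero {g} {m} {xs})          = ·ₗ-zero g m ys (xs ⊛ ys)

  ⊛-cong : ∀ {xs xs′ ys ys′} → xs ≋ xs′ → ys ≋ ys′ → xs ⊛ ys ≋ xs′ ⊛ ys′
  ⊛-cong {xs′ = xs′} {ys = ys} p q = ≋-trans (⊛-congˡ ys p) (⊛-congʳ xs′ q)

  ⊛-comm : ∀ xs ys → xs ⊛ ys ≋ ys ⊛ xs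
  ⊛-comm []       ys = ≡⇒≋ (≡.sym (⊛-zeroʳ ys))
    where
    ⊛-zeroʳ : ∀ ys → ys ⊛ [] ≡ []
    ⊛-zeroʳ []       = refl
    ⊛-zeroʳ (y ∷ ys) = ⊛-zeroʳ ys
  ⊛-comm (x ∷ xs) ys = ≋-trans
    (++-cong (map-cong ys (·ₜ-comm x)) (⊛-comm xs ys))
    (≋-sym (⊛-∷ʳ ys))
    where
    ⊛-∷ʳ : ∀ ys → ys ⊛ (x ∷ xs) ≋ map (_·ₜ x) ys ++ ys ⊛ xs
    ⊛-∷ʳ []       = ≋-refl
    ⊛-∷ʳ (y ∷ ys) = ≋-cons (≋-trans (++-congʳ (y ·ₗ xs) (⊛-∷ʳ ys))
      (≋-perm (↭.shifts (y ·ₗ xs) (map (_·ₜ x) ys))))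

  ·ₗ-⊛ : ∀ x ys zs → (x ·ₗ ys) ⊛ zs ≋ x ·ₗ (ys ⊛ zs)
  ·ₗ-⊛ x []       zs = ≋-refl
  ·ₗ-⊛ x (y ∷ ys) zs = ≋-trans
    (++-cong (≋-trans (map-cong zs (·ₜ-assoc x y)) (≡⇒≋ (List.map-∘ zs))) (·ₗ-⊛ x ys zs))
    (≡⇒≋ (≡.sym (List.map-++ (x ·ₜ_) (y ·ₗ zs) (ys ⊛ zs))))

  ⊛-assoc : ∀ xs ys zs → (xs ⊛ ys) ⊛ zs ≋ xs ⊛ (ys ⊛ zs)
  ⊛-assoc []       ys zs = ≋-refl
  ⊛-assoc (x ∷ xs) ys zs = ≋-trans
    (≡⇒≋ (List.concatMap-++ (_·ₗ zs) (x ·ₗ ys) (xs ⊛ ys)))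
    (++-cong (·ₗ-⊛ x ys zs) (⊛-assoc xs ys zs))

  ⊛-identityˡ : ∀ xs → one ⊛ xs ≋ xs
  ⊛-identityˡ xs = ≋-trans (≡⇒≋ (List.++-identityʳ (term R.1# G.ε (+ 0) ·ₗ xs)))
    (≋-trans (map-cong xs λ y → R.*-identityˡ _ , G.identityˡ _ , ℤ.+-identityˡ (Term.deg y))
      (≡⇒≋ (List.map-id xs)))

  ⊛-commutativeMonoid : CommutativeMonoid (c ⊔ a) (c ⊔ ℓ ⊔ a ⊔ b)
  ⊛-commutativeMonoid = record
    { Carrier = LPoly ; _≈_ = _≋_ ; _∙_ = _⊛_ ; ε = one
    ; isCommutativeMonoid = isCommutativeMonoidˡ record
      { isSemigroup = record
        { isMagma = record { isEquivalence = Setoid.isEquivalence ≋-setoid ; ∙-cong = ⊛-cong }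
        ; assoc = ⊛-assoc }
      ; identityˡ = ⊛-identityˡ
      ; comm = ⊛-comm } }

  open CommutativeSemigroupProperties (CommutativeMonoid.commutativeSemigroup ⊛-commutativeMonoid)
    public using () renaming (interchange to ⊛-interchange)

  ∏-cong : ∀ {n} {f g : Fin n → LPoly} → (∀ i → f i ≋ g i) → ∏ f ≋ ∏ g
  ∏-cong {zero}  f≋g = ≋-refl
  ∏-cong {suc n} f≋g = ⊛-cong (f≋g zero) (∏-cong (f≋g ∘ suc))

  ∏-distrib-⊛ : ∀ {n} (f g : Fin n → LPoly) → ∏ (λ i → f i ⊛ g i) ≋ ∏ f ⊛ ∏ g
  ∏-distrib-⊛ {zero}  f g = ≋-sym (⊛-identityˡ one)
  ∏-distrib-⊛ {suc n} f g = ≋-trans (⊛-congʳ (f zero ⊛ g zero) (∏-distrib-⊛ (f ∘ suc) (g ∘ suc)))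
    (⊛-interchange (f zero) (g zero) (∏ (f ∘ suc)) (∏ (g ∘ suc)))

  private module ΣG = MonoidSum G.monoid

  ∏-mono : ∀ {n} r (g : Fin n → G.Carrier) k →
    ∏ (λ i → mono r (g i) k) ≋ mono (powR r n) (ΣG.sum g) (+ n ℤ.* k)
  ∏-mono {zero}  r g k = ≋-refl
  ∏-mono {suc n} r g k = ≋-trans (⊛-congʳ (mono r (g zero) k) (∏-mono r (g ∘ suc) k))
    (mono-cong R.refl G.refl (≡.sym (ℤ.suc-* (+ n) k)))

  scale-≋-mono-⊛ : ∀ r xs → scale r xs ≋ mono r G.ε (+ 0) ⊛ xs
  scale-≋-mono-⊛ r xs = ≋-trans
    (map-cong xs λ y → R.refl , G.sym (G.identityˡ _) , ≡.sym (ℤ.+-identityˡ (Term.deg y)))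
    (≡⇒≋ (≡.sym (List.++-identityʳ (term r G.ε (+ 0) ·ₗ xs))))

  subInv-⊛ : ∀ xs ys → subInv (xs ⊛ ys) ≋ subInv xs ⊛ subInv ys
  subInv-⊛ []       ys = ≋-refl
  subInv-⊛ (x ∷ xs) ys = ≋-trans
    (≡⇒≋ (List.map-++ inv (x ·ₗ ys) (xs ⊛ ys)))
    (++-cong (≋-trans (≡⇒≋ (≡.sym (List.map-∘ ys)))
               (≋-trans (map-cong ys λ y → R.refl , G.refl , ℤ.neg-distrib-+ (Term.deg x) (Term.deg y))
                 (≡⇒≋ (List.map-∘ ys))))
      (subInv-⊛ xs ys))
    where
    inv : Term → Term
    inv (term s g n) = term s g (ℤ.- n)

  subInv-∏ : ∀ {n} (f : Fin n → LPoly) → subInv (∏ f) ≋ ∏ (subInv ∘ f)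
  subInv-∏ {zero}  f = ≋-refl
  subInv-∏ {suc n} f =
    ≋-trans (subInv-⊛ (f zero) (∏ (f ∘ suc))) (⊛-congʳ (subInv (f zero)) (subInv-∏ (f ∘ suc)))

  linearFactor : G.Carrier → LPoly
  linearFactor g = one ⊕ mono (R.- R.1#) g (+ 1)

  private
    -1*-1≈1 : (R.- R.1#) R.* (R.- R.1#) R.≈ R.1#
    -1*-1≈1 = R.trans (-1*x≈-x (R.- R.1#)) (-‿involutive R.1#)
      where open RingProperties R.ring

  -1^n*-1^n≈1 : ∀ n → powR (R.- R.1#) n R.* powR (R.- R.1#) n R.≈ R.1#
  -1^n*-1^n≈1 zero    = R.*-identityˡ R.1#
  -1^n*-1^n≈1 (suc n) = R.trans (interchange (R.- R.1#) _ (R.- R.1#) _)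
    (R.trans (R.*-cong -1*-1≈1 (-1^n*-1^n≈1 n)) (R.*-identityˡ R.1#))
    where open CommutativeSemigroupProperties R.*-commutativeSemigroup using (interchange)

  subInv-linearFactor⁻¹ : ∀ g →
    subInv (linearFactor (g G.⁻¹)) ≋ mono (R.- R.1#) (g G.⁻¹) -[1+ 0 ] ⊛ linearFactor g
  subInv-linearFactor⁻¹ g = ≋-trans (≋-perm (swap _ _ ↭.refl))
    (∷-cong {term _ _ _} {term _ _ _} (R.sym (R.*-identityʳ _) , G.sym (G.identityʳ _) , refl)
      (∷-cong {term _ _ _} {term _ _ _} (R.sym -1*-1≈1 , G.sym (G.inverseˡ g) , refl) ≋-refl))


module _ {a b} (G : AbelianGroup a b) {d : ℕ} {ψ : Vec ℤ d → AbelianGroup.Carrier G} (hom : IsHom G ψ) where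
  open AbelianGroup G
  open GroupProperties group using (identityˡ-unique; x≈z//y)
  private module ΣG = MonoidSum monoid

  IsHom-⁻¹ : IsHom G (λ α → ψ α ⁻¹)
  IsHom-⁻¹ α β = trans (⁻¹-cong (hom α β)) (sym (AbelianGroupProperties.⁻¹-∙-comm G (ψ α) (ψ β)))

  hom-zero : ψ (Vec.replicate d (+ 0)) ≈ ε
  hom-zero = identityˡ-unique ψ₀ ψ₀ (begin
    ψ₀ ∙ ψ₀                                                      ≈⟨ hom _ _ ⟨
    ψ (Vec.zipWith ℤ._+_ (Vec.replicate d (+ 0)) (Vec.replicate d (+ 0)))
      ≡⟨ ≡.cong ψ (Vec.zipWith-replicate ℤ._+_ (+ 0) (+ 0)) ⟩
    ψ₀                                                           ∎)
    where
    open SetoidReasoning setoid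
    ψ₀ : Carrier
    ψ₀ = ψ (Vec.replicate d (+ 0))

  hom-vsum : ∀ {n} (w : Fin n → Vec ℤ d) → ψ (vsum w) ≈ ΣG.sum (ψ ∘ w)
  hom-vsum {zero}  w = hom-zero
  hom-vsum {suc n} w = trans (hom (w zero) (vsum (w ∘ suc))) (∙-congˡ (hom-vsum (w ∘ suc)))

  hom-⊖ : ∀ α β → ψ (α ⊖ β) ≈ ψ α ∙ ψ β ⁻¹
  hom-⊖ α β = x≈z//y (ψ (α ⊖ β)) (ψ β) (ψ α)
    (trans (sym (hom (α ⊖ β) β)) (reflexive (≡.cong ψ (⊖-+-cancel α β))))

module _ {c ℓ a b} (R : CommutativeRing c ℓ) (G : AbelianGroup a b) {d : ℕ}
  (φ : Vec ℤ d → AbelianGroup.Carrier G) (hom : IsHom G φ) (v : Fin (suc d) → Vec ℤ d) where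
  open GroupRing R G
  open LaurentPolynomialAlgebra R G
  private
    module R = CommutativeRing R
    module G = AbelianGroup G

  φ′ : Vec ℤ d → G.Carrier
  φ′ α = φ α G.⁻¹

  hstar-reflect : ∀ L →
    hstar φ (map (reflect v) L) ≋ mono R.1# (φ (vsum v)) (+ suc d) ⊛ subInv (hstar φ′ L)
  hstar-reflect L = ≋-trans (termwise L) (≡⇒≋ (≡.sym (List.++-identityʳ _)))
    where
    termwise : ∀ L → hstar φ (map (reflect v) L) ≋ term R.1# (φ (vsum v)) (+ suc d) ·ₗ subInv (hstar φ′ L)
    termwise []            = ≋-refl
    termwise ((β , m) ∷ L) = ∷-cong {term _ _ _} {term _ _ _}
      (R.sym (R.*-identityˡ R.1#) , hom-⊖ G hom (vsum v) β , refl) (termwise L)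

  hstar-reciprocity : ∀ {L L′} → L′ ↭ map (reflect v) L →
    hstar φ L′ ≋ mono R.1# (φ (vsum v)) (+ suc d) ⊛ subInv (hstar φ′ L)
  hstar-reciprocity {L} L′↭ = ≋-trans (≋-perm (↭.map⁺ _ L′↭)) (hstar-reflect L)

  den-reciprocity :
    subInv (den v φ′) ≋ mono (powR (R.- R.1#) (suc d)) (φ′ (vsum v)) -[1+ d ] ⊛ den v φ
  den-reciprocity = begin
    subInv (den v φ′)
      ≈⟨ subInv-∏ (linearFactor ∘ φ′ ∘ v) ⟩
    ∏ (subInv ∘ linearFactor ∘ φ′ ∘ v)
      ≈⟨ ∏-cong (subInv-linearFactor⁻¹ ∘ φ ∘ v) ⟩
    ∏ (λ i → t⁻¹-monomial i ⊛ linearFactor (φ (v i)))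
      ≈⟨ ∏-distrib-⊛ t⁻¹-monomial (linearFactor ∘ φ ∘ v) ⟩
    ∏ t⁻¹-monomial ⊛ den v φ
      ≈⟨ ⊛-congˡ (den v φ) (∏-mono (R.- R.1#) (φ′ ∘ v) -[1+ 0 ]) ⟩
    mono (powR (R.- R.1#) (suc d)) (ΣG.sum (φ′ ∘ v)) (+ suc d ℤ.* -[1+ 0 ]) ⊛ den v φ
      ≈⟨ ⊛-congˡ (den v φ) (mono-cong R.refl weight degree) ⟩
    mono (powR (R.- R.1#) (suc d)) (φ′ (vsum v)) -[1+ d ] ⊛ den v φ ∎
    where
    open SetoidReasoning ≋-setoid
    module ΣG = MonoidSum G.monoid
    t⁻¹-monomial : Fin (suc d) → LPoly
    t⁻¹-monomial i = mono (R.- R.1#) (φ′ (v i)) -[1+ 0 ]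
    weight : ΣG.sum (φ′ ∘ v) G.≈ φ′ (vsum v)
    weight = G.sym (hom-vsum G (IsHom-⁻¹ G hom) v)
    degree : + suc d ℤ.* -[1+ 0 ] ≡ -[1+ d ]
    degree = ≡.trans (ℤ.*-comm (+ suc d) -[1+ 0 ]) (ℤ.-1*i≡-i (+ suc d))

  Ehrhart-reciprocity : ∀ {L L′} → L′ ↭ map (reflect v) L →
    subInvF (Ehrhart v φ′ L) ≈F scaleF (powR (R.- R.1#) (suc d)) (Ehrhart v φ L′)
  Ehrhart-reciprocity {L} {L′} L′↭ = ≋-sym (begin
    scale E (hstar φ L′) ⊛ subInv (den v φ′)
      ≈⟨ ⊛-cong (≋-trans (scale-≋-mono-⊛ E (hstar φ L′)) (⊛-congʳ E₁ (hstar-reciprocity L′↭)))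
                den-reciprocity ⟩
    (E₁ ⊛ (M ⊛ A)) ⊛ (M⁻ ⊛ D)   ≈⟨ ⊛-congˡ (M⁻ ⊛ D) (≋-sym (⊛-assoc E₁ M A)) ⟩
    ((E₁ ⊛ M) ⊛ A) ⊛ (M⁻ ⊛ D)   ≈⟨ ⊛-interchange (E₁ ⊛ M) A M⁻ D ⟩
    ((E₁ ⊛ M) ⊛ M⁻) ⊛ (A ⊛ D)   ≈⟨ ⊛-congˡ (A ⊛ D) monomials-cancel ⟩
    one ⊛ (A ⊛ D)               ≈⟨ ⊛-identityˡ (A ⊛ D) ⟩
    A ⊛ D                       ∎)
    where
    open SetoidReasoning ≋-setoid
    E : R.Carrier
    E = powR (R.- R.1#) (suc d)
    E₁ M M⁻ A D : LPoly
    E₁ = mono E G.ε (+ 0)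
    M  = mono R.1# (φ (vsum v)) (+ suc d)
    M⁻ = mono E (φ′ (vsum v)) -[1+ d ]
    A  = subInv (hstar φ′ L)
    D  = den v φ
    monomials-cancel : (E₁ ⊛ M) ⊛ M⁻ ≋ one
    monomials-cancel = mono-cong
      (R.trans (R.*-congʳ (R.*-identityʳ E)) (-1^n*-1^n≈1 (suc d)))
      (G.trans (G.∙-congʳ (G.identityˡ _)) (G.inverseʳ _))
      (ℤ.+-inverseʳ (+ suc d))


mainTheorem3 : ∀ {c ℓ a b} (R : CommutativeRing c ℓ) (G : AbelianGroup a b) (d : ℕ)
    (φ : Vec ℤ d → AbelianGroup.Carrier G) → IsHom G φ →
    (v : Fin (suc d) → Vec ℤ d) → AffinelyIndependent v →
    (S : Fin (suc d) → Bool) →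
    (L L′ : List (Point d)) →
    Enumerates (InΠ v S) L → Enumerates (InΠ v (not ∘ S)) L′ →
    ReciprocityConclusion R G φ v L L′
mainTheorem3 R G d φ hom v _ S L L′ enumL enumL′ =
  hstar-reciprocity R G φ hom v L′↭ , Ehrhart-reciprocity R G φ hom v L′↭
  where
  L′↭ : L′ ↭ map (reflect v) L
  L′↭ = enumeration-reflect v S enumL enumL′
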